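{- Let $K$ be a field of characteristic $0$, $n\ge2$, and $f=\sum a_{i_1,\dots,i_n}x_1^{i_1}\cdots x_n^{i_n}\in K[[x_1,\dots,x_n]]$ (not necessarily D-finite). Use variables $s,t,x_3,\dots,x_n$, write $\hat{\mathbf x}=(t,x_3,\dots,x_n)$, and let $\sigma(f)=\frac1s f\bigl(s,\tfrac ts,x_3,\dots,x_n\bigr)\in M$. Let $\Delta_{2,1}(f)=\sum a_{i_1,i_1,i_3,\dots,i_n}t^{i_1}x_3^{i_3}\cdots x_n^{i_n}$. (a) If $P=\sum_{j=\alpha}^{\beta}P_j(\hat{\mathbf x};D_t)D_s^j\in K[\hat{\mathbf x}]\langle D_t,D_s\rangle$ with $P_j\in K[\hat{\mathbf x}]\langle D_t\rangle$ and $P_\alpha\ne0$ satisfies $P(\sigma(f))=0$, then $P_\alpha(\Delta_{2,1}(f))=0$. (b) For $h\in\{3,\dots,n\}$, if $P_h=\sum_{j=\alpha_h}^{\beta_h}P_{h,j}(\hat{\mathbf x};D_{x_h})D_s^j\in K[\hat{\mathbf x}]\langle D_{x_h},D_s\rangle$ with $P_{h,j}\in K[\hat{\mathbf x}]\langle D_{x_h}\rangle$ and $P_{h,\alpha_h}\ne0$ satisfies $P_h(\sigma(f))=0$, then $P_{h,\alpha_h}(\Delta_{2,1}(f))=0$.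
   Context: $M$ is the set of formal series $\sum c_{a,\beta}s^a\hat{\mathbf x}^\beta$ with $a\in\mathbb Z$, $\beta\in\mathbb N^{n-1}$, such that for some $k\in\mathbb N$ all non-zero coefficients satisfy $a+|\beta|\ge -k$; operators with polynomial coefficients in $t,x_3,\dots,x_n$ and derivations $D_s=\partial/\partial s$, $D_t=\partial/\partial t$, $D_{x_h}=\partial/\partial x_h$ act on $M$ termwise. The substitution defining $\sigma(f)$ maps $x_1^{i_1}x_2^{i_2}\cdots x_n^{i_n}$ to $s^{i_1-i_2-1}t^{i_2}x_3^{i_3}\cdots x_n^{i_n}$. -}

module Defs where

open import Level using (_⊔_)
open import Algebra.Bundles using (CommutativeRing)
import Algebra.Definitions.RawMonoid as RawMonoidDefs
open import Data.Nat as ℕ using (ℕ; zero; suc; _≤_; _<_; _≤ᵇ_)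
open import Data.Nat.Properties using (≤-refl)
open import Data.Integer as ℤ using (ℤ; +_; -[1+_])
open import Data.Fin using (Fin; zero; suc)
open import Data.Vec as Vec using (Vec; []; _∷_; lookup; updateAt)
open import Data.Vec.Relation.Unary.Any using (Any)
open import Data.List as List using (List; []; _∷_; _++_; concatMap; upTo)
open import Data.Maybe using (Maybe; just; nothing)
open import Data.Product using (Σ; _×_; _,_; ∃)
open import Data.Sum using (_⊎_)
open import Data.Bool using (if_then_else_)
open import Data.Unit using (⊤)
open import Relation.Nullary using (¬_)

subExp : ∀ {k} → Vec ℕ k → Vec ℕ k → Maybe (Vec ℕ k)
subExp [] [] = just []
subExp (b ∷ bs) (g ∷ gs) with g ≤ᵇ b | subExp bs gs
... | Data.Bool.true  | just r = just ((b ℕ.∸ g) ∷ r)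
... | _               | _      = nothing

box : (k N : ℕ) → List (Vec ℕ k)
box zero    N = [] ∷ []
box (suc k) N = concatMap (λ e → List.map (e ∷_) (box k N)) (upTo (suc N))

module _ {c ℓ} (K : CommutativeRing c ℓ) where

  open CommutativeRing K renaming (Carrier to Kc)
  open RawMonoidDefs +-rawMonoid using () renaming (_×_ to _·ℕ_)

  record IsField : Set (c ⊔ ℓ) where
    field
      1≉0 : ¬ (1# ≈ 0#)
      inverse : ∀ x → ¬ (x ≈ 0#) → Σ Kc (λ y → (x * y) ≈ 1#)

  CharZero : Set ℓ
  CharZero = ∀ (k : ℕ) → ¬ ((suc k ·ℕ 1#) ≈ 0#)

  ι : ℤ → Kc
  ι (+ k)      = k ·ℕ 1#
  ι -[1+ k ]   = - (suc k ·ℕ 1#)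

  sumK : List Kc → Kc
  sumK = List.foldr _+_ 0#

  -- Σ_{j = lo}^{hi} g j  (empty if hi < lo)
  sumRange : ℕ → ℕ → (ℕ → Kc) → Kc
  sumRange lo hi g = sumK (List.map (λ i → g (lo ℕ.+ i)) (upTo (suc hi ℕ.∸ lo)))

  -- The variables x̂ = (t, x₃, …, xₙ) are indexed by
  -- Fin (suc m) with n = m + 2 (index zero is t, index suc i is x_{i+3}).
  -- E = ⊤ : power series in x̂ (K[[x̂]]);  E = ℤ : series in s, x̂
  -- (the exponent of s), i.e. the ambient space of M.

  Series : Set → ℕ → Set c
  Series E m = E → Vec ℕ (suc m) → Kc

  PowerSeries : ℕ → Set c
  PowerSeries m = Vec ℕ (2 ℕ.+ m) → Kc

  InM : ∀ {m} → Series ℤ m → Set ℓ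
  InM {m} F = ∃ λ (k : ℕ) → ∀ a β →
    (a ℤ.+ (+ Vec.sum β)) ℤ.< ℤ.- (+ k) → F a β ≈ 0#

  -- σ(f) = (1/s) f(s, t/s, x₃, …, xₙ):
  -- x₁^{i₁} x₂^{i₂} x₃^{i₃}⋯ ↦ s^{i₁-i₂-1} t^{i₂} x₃^{i₃}⋯
  σ : ∀ {m} → PowerSeries m → Series ℤ m
  σ f a (b ∷ rest) with a ℤ.+ (+ suc b)
  ... | + i₁     = f (i₁ ∷ b ∷ rest)
  ... | -[1+ _ ] = 0#

  Δ₂₁ : ∀ {m} → PowerSeries m → Series ⊤ m
  Δ₂₁ f _ (b ∷ rest) = f (b ∷ b ∷ rest)

  mulMono : ∀ {E m} → Vec ℕ (suc m) → Series E m → Series E m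
  mulMono γ F e β with subExp β γ
  ... | just β' = F e β'
  ... | nothing = 0#

  Dvar : ∀ {E m} → Fin (suc m) → Series E m → Series E m
  Dvar d F e β = (suc (lookup β d) ·ℕ 1#) * F e (updateAt β d suc)

  Ds : ∀ {m} → Series ℤ m → Series ℤ m
  Ds F a β = ι (a ℤ.+ + 1) * F (a ℤ.+ + 1) β

  iter : ∀ {A : Set c} → ℕ → (A → A) → A → A
  iter zero    g x = x
  iter (suc k) g x = g (iter k g x)

  -- Elements of K[x̂]⟨D_d⟩ (d an index of x̂), written in the normal form
  -- Σ coeff(γ,k) x̂^γ D_d^k with finitely many nonzero coefficients.

  record WeylOp (m : ℕ) : Set (c ⊔ ℓ) where
    field
      coeff   : Vec ℕ (suc m) → ℕ → Kc
      bound   : ℕ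
      support : ∀ γ k → (bound < k ⊎ Any (bound <_) γ) → coeff γ k ≈ 0#
  open WeylOp public

  NonZeroOp : ∀ {m} → WeylOp m → Set ℓ
  NonZeroOp P = ∃ λ γ → ∃ λ k → ¬ (coeff P γ k ≈ 0#)

  applyOp : ∀ {E m} → Fin (suc m) → WeylOp m → Series E m → Series E m
  applyOp {m = m} d P F e β =
    sumK (List.map (λ γ →
      sumK (List.map (λ k → coeff P γ k * mulMono γ (iter k (Dvar d) F) e β)
                     (upTo (suc (bound P)))))
      (box (suc m) (bound P)))

  IsZero : ∀ {E m} → Series E m → Set ℓ
  IsZero F = ∀ e β → F e β ≈ 0#

  Lemma44Claim : ∀ {m} → Fin (suc m) → Set (c ⊔ ℓ)
  Lemma44Claim {m} d =
    ∀ (f : PowerSeries m) (α β : ℕ) (P : ℕ → WeylOp m) →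
      α ≤ β →
      NonZeroOp (P α) →
      IsZero (λ a γ → sumRange α β (λ j →
                applyOp d (P j) (iter j Ds (σ f)) a γ)) →
      IsZero (applyOp d (P α) (Δ₂₁ f))

-- The operators P_j ∈ K[x̂]⟨D_d⟩ act on the x̂-variables only, so they commute
-- with extracting the coefficient of a power of s.  Extract the coefficient of
-- s^{-α-1}: since D_s^j lowers the s-exponent by j, this coefficient of
-- D_s^j σ(f) comes from s^{j-α-1}, and for j > α it vanishes because the
-- chain passes through D_s s^0 = 0.  For j = α it is (−1)^α α! times
-- the s^{-1}-coefficient of σ(f), which is exactly Δ₂₁(f).  Hence
-- P(σ f) = 0 gives (−1)^α α! · P_α(Δ₂₁ f) = 0, and (−1)^α α! is invertible in
-- characteristic 0.
module Submission where

open import Defs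
open import Algebra.Bundles using (CommutativeRing)
import Algebra.Properties.CommutativeSemigroup as CommutativeSemigroupProperties
import Algebra.Properties.Ring as RingProperties
import Algebra.Definitions.RawMonoid as RawMonoidDefs
open import Data.Nat as ℕ using (ℕ; zero; suc; _≤_; _<_; s≤s)
import Data.Nat.Properties as ℕₚ
open import Data.Integer using (ℤ; -[1+_])
open import Data.Fin using (Fin; zero; suc)
open import Data.Vec using (Vec; _∷_)
open import Data.List as List using (List; []; _∷_; applyUpTo; upTo)
open import Data.Maybe using (just; nothing)
open import Data.Product using (_×_; _,_)
open import Data.Unit using (tt)
open import Relation.Nullary using (¬_)
open import Relation.Binary.PropositionalEquality as P using (_≡_)
import Relation.Binary.Reasoning.Setoid as SetoidReasoning

module _ {c ℓ} (K : CommutativeRing c ℓ) where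

  open CommutativeRing K renaming (Carrier to Kc)
  open RawMonoidDefs +-rawMonoid using () renaming (_×_ to _·ℕ_)
  open CommutativeSemigroupProperties *-commutativeSemigroup using (x∙yz≈y∙xz)
  open RingProperties ring using (-0#≈0#; -‿injective)
  open SetoidReasoning setoid

  sumK-scale : ∀ {X : Set} (xs : List X) (u v : X → Kc) (k : Kc) →
    (∀ x → u x ≈ k * v x) →
    sumK K (List.map u xs) ≈ k * sumK K (List.map v xs)
  sumK-scale []       u v k u≈kv = sym (zeroʳ k)
  sumK-scale (x ∷ xs) u v k u≈kv = begin
    u x + sumK K (List.map u xs)          ≈⟨ +-cong (u≈kv x) (sumK-scale xs u v k u≈kv) ⟩
    k * v x + k * sumK K (List.map v xs)  ≈⟨ distribˡ k _ _ ⟨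
    k * (v x + sumK K (List.map v xs))    ∎

  sumK-applyUpTo-zero : ∀ (h : ℕ → Kc) (g : ℕ → ℕ) n → (∀ i → h (g i) ≈ 0#) →
    sumK K (List.map h (applyUpTo g n)) ≈ 0#
  sumK-applyUpTo-zero h g zero    h∘g≈0 = refl
  sumK-applyUpTo-zero h g (suc n) h∘g≈0 = begin
    h (g 0) + sumK K (List.map h (applyUpTo (λ i → g (suc i)) n))
      ≈⟨ +-cong (h∘g≈0 0) (sumK-applyUpTo-zero h (λ i → g (suc i)) n (λ i → h∘g≈0 (suc i))) ⟩
    0# + 0#  ≈⟨ +-identityˡ 0# ⟩
    0#       ∎

  sumRange-lowest : ∀ {α β} (g : ℕ → Kc) → α ≤ β → (∀ j → α < j → g j ≈ 0#) →
    sumRange K α β g ≈ g α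
  sumRange-lowest {α} {β} g α≤β higher≈0 rewrite ℕₚ.+-∸-assoc 1 α≤β = begin
    g (α ℕ.+ 0) + sumK K (List.map (λ i → g (α ℕ.+ i)) (applyUpTo suc (β ℕ.∸ α)))
      ≈⟨ +-congˡ (sumK-applyUpTo-zero (λ i → g (α ℕ.+ i)) suc (β ℕ.∸ α)
                    (λ i → higher≈0 (α ℕ.+ suc i) (ℕₚ.m<m+n α (s≤s ℕ.z≤n)))) ⟩
    g (α ℕ.+ 0) + 0#  ≈⟨ +-identityʳ _ ⟩
    g (α ℕ.+ 0)       ≡⟨ P.cong g (ℕₚ.+-identityʳ α) ⟩
    g α               ∎

  module _ {m : ℕ} {E E' : Set} (d : Fin (suc m)) (e : E) (e' : E') (k : Kc) where

    iter-Dvar-scale : (F : Series K E m) (G : Series K E' m) →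
      (∀ β → F e β ≈ k * G e' β) →
      ∀ n β → iter K n (Dvar K d) F e β ≈ k * iter K n (Dvar K d) G e' β
    iter-Dvar-scale F G F≈kG zero    β = F≈kG β
    iter-Dvar-scale F G F≈kG (suc n) β =
      trans (*-congˡ (iter-Dvar-scale F G F≈kG n _)) (x∙yz≈y∙xz _ k _)

    mulMono-scale : (γ : Vec ℕ (suc m)) (F : Series K E m) (G : Series K E' m) →
      (∀ β → F e β ≈ k * G e' β) →
      ∀ β → mulMono K γ F e β ≈ k * mulMono K γ G e' β
    mulMono-scale γ F G F≈kG β with subExp β γ
    ... | just β′ = F≈kG β′
    ... | nothing = sym (zeroʳ k)

    applyOp-scale : (Q : WeylOp K m) (F : Series K E m) (G : Series K E' m) →
      (∀ β → F e β ≈ k * G e' β) →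
      ∀ β → applyOp K d Q F e β ≈ k * applyOp K d Q G e' β
    applyOp-scale Q F G F≈kG β =
      sumK-scale (box (suc m) (bound Q)) _ _ k λ γ →
      sumK-scale (upTo (suc (bound Q))) _ _ k λ n →
        trans (*-congˡ (mulMono-scale γ _ _ (iter-Dvar-scale F G F≈kG n) β))
              (x∙yz≈y∙xz _ k _)

  applyOp-vanishes : ∀ {m E} (d : Fin (suc m)) (Q : WeylOp K m) (F : Series K E m) e →
    (∀ β → F e β ≈ 0#) → ∀ β → applyOp K d Q F e β ≈ 0#
  applyOp-vanishes d Q F e F≈0 β =
    trans (applyOp-scale d e e 0# Q F F (λ β′ → trans (F≈0 β′) (sym (zeroˡ _))) β)
          (zeroˡ _)

  -- The factor (−1)·(−2)⋯(−p) = (−1)^p p! picked up by D_s^p from s^{-1} to s^{-p-1}.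
  signedFactorial : ℕ → Kc
  signedFactorial zero    = 1#
  signedFactorial (suc p) = ι K -[1+ p ] * signedFactorial p

  module _ {m : ℕ} (F : Series K ℤ m) where

    iter-Ds-below : ∀ p n → p < n → ∀ β → iter K n (Ds K) F -[1+ p ] β ≈ 0#
    iter-Ds-below zero    (suc n) _         β = zeroˡ _
    iter-Ds-below (suc p) (suc n) (s≤s p<n) β =
      trans (*-congˡ (iter-Ds-below p n p<n β)) (zeroʳ _)

    iter-Ds-residue : ∀ p β →
      iter K p (Ds K) F -[1+ p ] β ≈ signedFactorial p * F -[1+ 0 ] β
    iter-Ds-residue zero    β = sym (*-identityˡ _)
    iter-Ds-residue (suc p) β =
      trans (*-congˡ (iter-Ds-residue p β)) (sym (*-assoc _ _ _))

  σ-residue : ∀ {m} (f : PowerSeries K m) β → σ K f -[1+ 0 ] β ≡ Δ₂₁ K f tt β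
  σ-residue f (b ∷ rest) = P.refl

  module _ (field′ : IsField K) (charZero : CharZero K) where

    *-cancelˡ-nonzero : ∀ x y → ¬ (x ≈ 0#) → x * y ≈ 0# → y ≈ 0#
    *-cancelˡ-nonzero x y x≉0 xy≈0 with IsField.inverse field′ x x≉0
    ... | x⁻¹ , xx⁻¹≈1 = begin
      y              ≈⟨ *-identityˡ y ⟨
      1# * y         ≈⟨ *-congʳ (trans (sym xx⁻¹≈1) (*-comm x x⁻¹)) ⟩
      (x⁻¹ * x) * y  ≈⟨ *-assoc x⁻¹ x y ⟩
      x⁻¹ * (x * y)  ≈⟨ *-congˡ xy≈0 ⟩
      x⁻¹ * 0#       ≈⟨ zeroʳ x⁻¹ ⟩
      0#             ∎

    ι-negative≉0 : ∀ p → ¬ (ι K -[1+ p ] ≈ 0#)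
    ι-negative≉0 p -p≈0 = charZero p (-‿injective (trans -p≈0 (sym -0#≈0#)))

    signedFactorial-cancel : ∀ p y → signedFactorial p * y ≈ 0# → y ≈ 0#
    signedFactorial-cancel zero    y 1y≈0 = trans (sym (*-identityˡ y)) 1y≈0
    signedFactorial-cancel (suc p) y cy≈0 =
      signedFactorial-cancel p y
        (*-cancelˡ-nonzero _ _ (ι-negative≉0 p) (trans (sym (*-assoc _ _ _)) cy≈0))

    lemma44 : ∀ {m} (d : Fin (suc m)) → Lemma44Claim K d
    lemma44 d f α β P α≤β _ PσF≈0 tt γ = signedFactorial-cancel α _ (begin
      signedFactorial α * applyOp K d (P α) (Δ₂₁ K f) tt γ
        ≈⟨ applyOp-scale d -[1+ α ] tt (signedFactorial α) (P α) _ _ residue γ ⟨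
      coefficient α      ≈⟨ sumRange-lowest coefficient α≤β higher≈0 ⟨
      sumRange K α β coefficient  ≈⟨ PσF≈0 -[1+ α ] γ ⟩
      0#                 ∎)
      where
      coefficient : ℕ → Kc
      coefficient j = applyOp K d (P j) (iter K j (Ds K) (σ K f)) -[1+ α ] γ

      residue : ∀ β′ → iter K α (Ds K) (σ K f) -[1+ α ] β′
                         ≈ signedFactorial α * Δ₂₁ K f tt β′
      residue β′ = trans (iter-Ds-residue (σ K f) α β′)
                         (*-congˡ (reflexive (σ-residue f β′)))

      higher≈0 : ∀ j → α < j → coefficient j ≈ 0#
      higher≈0 j α<j = applyOp-vanishes d (P j) _ -[1+ α ]
                         (iter-Ds-below (σ K f) α j α<j) γ

lemma4p4 : ∀ {c ℓ} (K : CommutativeRing c ℓ) → IsField K → CharZero K →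
    (m : ℕ) →
    Lemma44Claim K {m} zero × (∀ (i : Fin m) → Lemma44Claim K {m} (suc i))
lemma4p4 K field′ charZero m =
  lemma44 K field′ charZero zero , λ i → lemma44 K field′ charZero (suc i)
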